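{- Let $G=(V,E)$ satisfy the standing assumptions and have highway dimension at most $h$. Let $k\ge 0$. There is a constant $c$ depending only on $h$ and $k$ such that for every $r>0$: if $E'$ is the set of edges of $G$ of weight at least $r/3$, $V(E')$ the set of their endpoints, and $C$ is an $(r/3,k)$ vertex cover of $G$, then $C\cup V(E')$ is an $(r,c)$-SPHS.
   Context: Standing assumptions: $G$ is a finite connected undirected graph, edge weights at least $1$, shortest paths unique ($p(u,w)$, length $d(u,w)$), every edge is the shortest path between its endpoints. $B(v,r)=\{v': d(v,v')\le r\}$; $\mathrm{maxedge}(p)$ is the maximum edge weight on path $p$; $V(p)$ the vertex set of $p$. For a shortest path $p$ from $u$ to $w$ and $r>0$, an $r$-witness of $p$ is a shortest path $p'$ of length at least $r$ containing $p$ as a subpath, with endpoints $u$ or a neighbor of $u$, and $w$ or a neighbor of $w$; $p$ is $r$-significant if it has an $r$-witness; $\mathcal P(r)$ is the set of all $r$-significant paths. $d(v,q)$ is the distance from $v$ to the nearest vertex of path $q$; $S(v,r)$ is the set of $r$-significant paths with an $r$-witness $p'$ satisfying $d(v,p')\le 2r$; the highway dimension is the least $h$ such that for all $r>0,v\in V$ some $C\subseteq V$, $|C|\le h$, meets every path of $S(v,r)$. An $(r,k)$ vertex cover is a set $C\subseteq V$ such that (1) every shortest path $p(v_1,v_2)$ with $d(v_1,v_2)>r$ and $\mathrm{maxedge}(p(v_1,v_2))\le r$ contains a vertex of $C$, and (2) $|B(v,2r)\cap C|\le k$ for all $v$. An $(r,c)$-SPHS (sparse shortest path hitting set) is a set $C\subseteq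 V$ such that (1) $C\cap V(p)\neq\emptyset$ for every $p\in\mathcal P(r)$, and (2) $|C\cap B(v,2r)|\le c$ for all $v\in V$.
   Formalization: The edge weights of G and the scale r take values in the rationals. -}

module Defs where

open import Level using (0ℓ)
open import Data.Nat using (ℕ)
import Data.Nat
open import Data.Fin using (Fin)
open import Data.Maybe using (Maybe; just)
open import Data.List using (List; []; _∷_; _++_; length; head; last)
open import Data.List.Membership.Propositional using (_∈_)
open import Data.List.Relation.Unary.All using (All)
open import Data.List.Relation.Unary.Unique.Propositional using (Unique)
open import Data.List.Relation.Unary.Linked using (Linked)
open import Data.Rational using (ℚ; 0ℚ; 1ℚ; _+_; _*_; _≤_; _<_; _⊔_; _/_)
open import Data.Integer using (+_)
open import Data.Product using (Σ; ∃; ∃-syntax; _×_; _,_)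
open import Data.Sum using (_⊎_)
open import Relation.Binary.PropositionalEquality using (_≡_)

-- A finite undirected graph with vertex set Fin n, an edge relation E and
-- rational edge weights w (w u v is only meaningful when E u v holds).
record Graph : Set₁ where
  field
    n    : ℕ
    E    : Fin n → Fin n → Set
    w    : Fin n → Fin n → ℚ
    E-sym : ∀ {u v} → E u v → E v u
    w-sym : ∀ {u v} → E u v → w u v ≡ w v u

module _ (G : Graph) where
  open Graph G

  V : Set
  V = Fin n

  IsWalk : List V → Set
  IsWalk = Linked E

  WalkFrom : V → V → List V → Set
  WalkFrom u v p = IsWalk p × head p ≡ just u × last p ≡ just v

  len : List V → ℚ
  len []             = 0ℚ
  len (x ∷ [])       = 0ℚ
  len (x ∷ y ∷ xs)   = w x y + len (y ∷ xs)

  maxedge : List V → ℚ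
  maxedge []           = 0ℚ
  maxedge (x ∷ [])     = 0ℚ
  maxedge (x ∷ y ∷ xs) = w x y ⊔ maxedge (y ∷ xs)

  IsSP : V → V → List V → Set
  IsSP u v p = WalkFrom u v p × (∀ q → WalkFrom u v q → len p ≤ len q)

  record StandingAssumptions : Set where
    field
      connected  : ∀ u v → ∃[ p ] WalkFrom u v p
      weight≥1   : ∀ {u v} → E u v → 1ℚ ≤ w u v
      uniqueSP   : ∀ u v p q → IsSP u v p → IsSP u v q → p ≡ q
      edgeIsSP   : ∀ {u v} → E u v → IsSP u v (u ∷ v ∷ [])

  DistLe : V → V → ℚ → Set
  DistLe u v r = ∃[ p ] (IsSP u v p × len p ≤ r)

  Ball : V → ℚ → V → Set
  Ball v r x = DistLe v x r

  Meets : (V → Set) → List V → Set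
  Meets C p = ∃[ x ] (x ∈ p × C x)

  -- |{x | P x}| ≤ k : every duplicate-free list of elements satisfying P has length ≤ k
  AtMost : ℕ → (V → Set) → Set
  AtMost k P = ∀ (xs : List V) → Unique xs → All P xs → length xs Data.Nat.≤ k

  Subpath : List V → List V → Set
  Subpath p p' = ∃[ as ] ∃[ bs ] (p' ≡ as ++ p ++ bs)

  UOrNbr : V → V → Set
  UOrNbr u x = x ≡ u ⊎ E x u

  Witness : ℚ → V → V → List V → List V → Set
  Witness r u v p p' =
    ∃[ a ] ∃[ b ] (IsSP a b p' × r ≤ len p' × Subpath p p' × UOrNbr u a × UOrNbr v b)

  Significant : ℚ → List V → Set
  Significant r p = ∃[ u ] ∃[ v ] (IsSP u v p × ∃[ p' ] Witness r u v p p')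

  InS : V → ℚ → List V → Set
  InS x r p = ∃[ u ] ∃[ v ] (IsSP u v p ×
      ∃[ p' ] (Witness r u v p p' × Meets (Ball x (r + r)) p'))

  HighwayDimAtMost : ℕ → Set
  HighwayDimAtMost h = ∀ (r : ℚ) → 0ℚ < r → ∀ (x : V) →
    ∃[ C ] (length C Data.Nat.≤ h × ∀ p → InS x r p → Meets (λ y → y ∈ C) p)

  VertexCover : ℚ → ℕ → (V → Set) → Set
  VertexCover r k C =
    (∀ v₁ v₂ p → IsSP v₁ v₂ p → r < len p → maxedge p ≤ r → Meets C p)
    × (∀ v → AtMost k (λ x → Ball v (r + r) x × C x))

  SPHS : ℚ → ℕ → (V → Set) → Set
  SPHS r c C =
    (∀ p → Significant r p → Meets C p)
    × (∀ v → AtMost c (λ x → Ball v (r + r) x × C x))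

  UnionHeavyEndpoints : ℚ → (V → Set) → V → Set
  UnionHeavyEndpoints s C x = C x ⊎ ∃[ y ] (E x y × s ≤ w x y)

third : ℚ → ℚ
third r = r * (+ 1 / 3)

{-# OPTIONS --safe #-}
-- Write s = r/3.  An r-witness extends a significant path p by at most one edge at each
-- end.  If p, or one of these extending edges, has an edge of weight ≥ s, then an endpoint
-- of a heavy edge lies on p.  Otherwise both extensions are shorter than s, so p is longer
-- than s with all edges of weight ≤ s, and the vertex cover meets it.
--
-- For sparsity take hubs H for S(v, 2s).  Cutting a shortest path from v to x ∈ B(v, 6s)
-- where the remaining length drops to 2s yields a path of S(v, 2s), so x lies within 2s of
-- v or of a hub.  A ball B(z, 2s) holds at most k cover vertices, and each heavy endpoint in
-- it is a hub for S(z, s), its trivial path being s-significant; hence the bound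
-- (1 + h)(k + h).
module Submission where

open import Defs
open import Level using (0ℓ)
open import Data.Nat as ℕ using (ℕ; suc; z≤n; s≤s)
import Data.Nat.Properties as ℕ
open import Data.Rational using (ℚ; 0ℚ; 1ℚ; _+_; _*_; _≤_; _<_; -_; _/_; positive)
open import Data.Rational.Properties
open import Data.Rational.Solver using (module +-*-Solver)
open import Data.Integer using () renaming (+_ to ⁺_)
open import Data.List using (List; []; _∷_; _++_; length; head; last)
open import Data.List.Properties using (++-assoc; ++-identityʳ)
open import Data.List.Membership.Propositional using (_∈_; lose)
open import Data.List.Membership.Propositional.Properties using (∈-∃++)
open import Data.List.Relation.Unary.All as All using (All; []; _∷_)
open import Data.List.Relation.Unary.Any as Any using (Any; here; there)
open import Data.List.Relation.Unary.AllPairs using ([]; _∷_)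
open import Data.List.Relation.Unary.Unique.Propositional using (Unique)
open import Data.List.Relation.Unary.Linked as Linked using (Linked; []; [-]; _∷_)
open import Data.List.Relation.Binary.Sublist.Propositional as Sublist using ([]; _∷_; _∷ʳ_)
open import Data.List.Relation.Binary.Sublist.Propositional.Properties using (All-resp-⊆)
open import Data.Maybe using (just)
open import Data.Maybe.Properties using (just-injective)
open import Data.Product using (∃; ∃₂; ∃-syntax; _×_; _,_; proj₁; proj₂; map₂)
open import Data.Sum using (_⊎_; inj₁; inj₂)
open import Data.Empty using (⊥-elim)
open import Relation.Nullary using (yes; no)
open import Relation.Unary using (Pred; _⊆_; _∪_; _∩_)
open import Relation.Binary.PropositionalEquality
  using (_≡_; refl; sym; trans; cong; cong₂; subst; subst₂; module ≡-Reasoning)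

+-cancelˡ-≤ : ∀ a {x y} → a + x ≤ a + y → x ≤ y
+-cancelˡ-≤ a {x} {y} a+x≤a+y = subst₂ _≤_ (neg-cancel x) (neg-cancel y) (+-monoʳ-≤ (- a) a+x≤a+y)
  where
  neg-cancel : ∀ z → - a + (a + z) ≡ z
  neg-cancel z = begin
    - a + (a + z)  ≡⟨ +-assoc (- a) a z ⟨
    (- a + a) + z  ≡⟨ cong (_+ z) (+-inverseˡ a) ⟩
    0ℚ + z         ≡⟨ +-identityˡ z ⟩
    z              ∎
    where open ≡-Reasoning

+-cancelʳ-≤ : ∀ a {x y} → x + a ≤ y + a → x ≤ y
+-cancelʳ-≤ a {x} {y} x+a≤y+a = +-cancelˡ-≤ a (subst₂ _≤_ (+-comm x a) (+-comm y a) x+a≤y+a)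

long-middle : ∀ {s a m b} → s + (s + s) ≤ a + (m + b) → a < s → b < s → s < m
long-middle {s} {m = m} 3s≤ a<s b<s with m ≤? s
... | no  m≰s = ≰⇒> m≰s
... | yes m≤s = ⊥-elim (<-irrefl refl (≤-<-trans 3s≤ (+-mono-< a<s (+-mono-≤-< m≤s b<s))))

third-pos : ∀ {r} → 0ℚ < r → 0ℚ < third r
third-pos {r} r>0 = positive⁻¹ (third r) {{pos*pos⇒pos r {{positive r>0}} (⁺ 1 / 3)}}

double-pos : ∀ {t} → 0ℚ < t → 0ℚ < t + t
double-pos t>0 = +-mono-< t>0 t>0

third-sum : ∀ r → third r + (third r + third r) ≡ r
third-sum r = begin
  r * ⅓ + (r * ⅓ + r * ⅓)  ≡⟨ cong (r * ⅓ +_) (*-distribˡ-+ r ⅓ ⅓) ⟨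
  r * ⅓ + r * (⅓ + ⅓)      ≡⟨ *-distribˡ-+ r ⅓ (⅓ + ⅓) ⟨
  r * 1ℚ                   ≡⟨ *-identityʳ r ⟩
  r                        ∎
  where
  open ≡-Reasoning
  ⅓ : ℚ
  ⅓ = ⁺ 1 / 3

double-sixths : ∀ r → r + r ≡ ((third r + third r) + (third r + third r)) + (third r + third r)
double-sixths r = trans (cong₂ _+_ (sym (third-sum r)) (sym (third-sum r)))
  (solve 1 (λ s → (s :+ (s :+ s)) :+ (s :+ (s :+ s)) := ((s :+ s) :+ (s :+ s)) :+ (s :+ s)) refl (third r))
  where open +-*-Solver

module _ {A : Set} where

  HasAtMost : ℕ → Pred A 0ℓ → Set
  HasAtMost k P = ∀ xs → Unique xs → All P xs → length xs ℕ.≤ k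

  Unique-resp-⊇ : ∀ {xs ys : List A} → ys Sublist.⊆ xs → Unique xs → Unique ys
  Unique-resp-⊇ []             []         = []
  Unique-resp-⊇ (_ ∷ʳ ys⊆xs)   (_ ∷ xs!)  = Unique-resp-⊇ ys⊆xs xs!
  Unique-resp-⊇ (refl ∷ ys⊆xs) (x∉ ∷ xs!) = All-resp-⊆ ys⊆xs x∉ ∷ Unique-resp-⊇ ys⊆xs xs!

  partition-∪ : ∀ {P Q : Pred A 0ℓ} xs → All (P ∪ Q) xs →
    ∃₂ λ ys zs → ys Sublist.⊆ xs × zs Sublist.⊆ xs × All P ys × All Q zs ×
                 length xs ≡ length ys ℕ.+ length zs
  partition-∪ [] [] = [] , [] , [] , [] , [] , [] , refl
  partition-∪ (x ∷ xs) (inj₁ px ∷ pqs) with partition-∪ xs pqs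
  ... | ys , zs , ys⊆ , zs⊆ , ps , qs , eq =
    x ∷ ys , zs , refl ∷ ys⊆ , x ∷ʳ zs⊆ , px ∷ ps , qs , cong suc eq
  partition-∪ (x ∷ xs) (inj₂ qx ∷ pqs) with partition-∪ xs pqs
  ... | ys , zs , ys⊆ , zs⊆ , ps , qs , eq =
    ys , x ∷ zs , x ∷ʳ ys⊆ , refl ∷ zs⊆ , ps , qx ∷ qs ,
    trans (cong suc eq) (sym (ℕ.+-suc (length ys) (length zs)))

  HasAtMost-mono : ∀ {k} {P Q : Pred A 0ℓ} → P ⊆ Q → HasAtMost k Q → HasAtMost k P
  HasAtMost-mono P⊆Q Q≤k xs xs! ps = Q≤k xs xs! (All.map P⊆Q ps)

  HasAtMost-weaken : ∀ {a b} {P : Pred A 0ℓ} → a ℕ.≤ b → HasAtMost a P → HasAtMost b P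
  HasAtMost-weaken a≤b P≤a xs xs! ps = ℕ.≤-trans (P≤a xs xs! ps) a≤b

  HasAtMost-∪ : ∀ {a b} {P Q : Pred A 0ℓ} → HasAtMost a P → HasAtMost b Q → HasAtMost (a ℕ.+ b) (P ∪ Q)
  HasAtMost-∪ {a} {b} P≤a Q≤b xs xs! pqs with partition-∪ xs pqs
  ... | ys , zs , ys⊆ , zs⊆ , ps , qs , eq = subst (ℕ._≤ a ℕ.+ b) (sym eq)
    (ℕ.+-mono-≤ (P≤a ys (Unique-resp-⊇ ys⊆ xs!) ps) (Q≤b zs (Unique-resp-⊇ zs⊆ xs!) qs))

  HasAtMost-⋃ : ∀ {b} {T : A → Pred A 0ℓ} → (∀ z → HasAtMost b (T z)) →
    ∀ Z → HasAtMost (length Z ℕ.* b) (λ x → Any (λ z → T z x) Z)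
  HasAtMost-⋃ T≤b []      []      _ _        = z≤n
  HasAtMost-⋃ T≤b []      (_ ∷ _) _ (() ∷ _)
  HasAtMost-⋃ T≤b (z ∷ Z) = HasAtMost-mono Any.toSum (HasAtMost-∪ (T≤b z) (HasAtMost-⋃ T≤b Z))

  HasAtMost-≡ : ∀ z → HasAtMost 1 (_≡ z)
  HasAtMost-≡ z []          _               _                 = z≤n
  HasAtMost-≡ z (_ ∷ [])    _               _                 = s≤s z≤n
  HasAtMost-≡ z (_ ∷ _ ∷ _) ((x≢y ∷ _) ∷ _) (refl ∷ refl ∷ _) = ⊥-elim (x≢y refl)

  HasAtMost-∈ : ∀ Z → HasAtMost (length Z) (_∈ Z)
  HasAtMost-∈ Z = subst (λ n → HasAtMost n (_∈ Z)) (ℕ.*-identityʳ (length Z)) (HasAtMost-⋃ HasAtMost-≡ Z)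

  head≡just⇒∷ : ∀ {u} (l : List A) → head l ≡ just u → ∃ λ l₀ → l ≡ u ∷ l₀
  head≡just⇒∷ (x ∷ l) eq with just-injective eq
  ... | refl = l , refl

  last≡just⇒∷ʳ : ∀ {v} (l : List A) → last l ≡ just v → ∃ λ l₁ → l ≡ l₁ ++ v ∷ []
  last≡just⇒∷ʳ (x ∷ []) eq with just-injective eq
  ... | refl = [] , refl
  last≡just⇒∷ʳ (x ∷ y ∷ l) eq with last≡just⇒∷ʳ (y ∷ l) eq
  ... | l₁ , eq₁ = x ∷ l₁ , cong (x ∷_) eq₁

  head≡just⇒∈ : ∀ {u} (l : List A) → head l ≡ just u → u ∈ l
  head≡just⇒∈ (x ∷ l) eq = here (sym (just-injective eq))

  last≡just⇒∈ : ∀ {v} (l : List A) → last l ≡ just v → v ∈ l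
  last≡just⇒∈ (x ∷ [])    eq = here (sym (just-injective eq))
  last≡just⇒∈ (x ∷ y ∷ l) eq = there (last≡just⇒∈ (y ∷ l) eq)

  head-++-∷ : ∀ (P : List A) y Q → head (P ++ y ∷ Q) ≡ head (P ++ y ∷ [])
  head-++-∷ []      y Q = refl
  head-++-∷ (x ∷ P) y Q = refl

  last-++-∷ : ∀ (P : List A) y Q → last (P ++ y ∷ Q) ≡ last (y ∷ Q)
  last-++-∷ []           y Q = refl
  last-++-∷ (x ∷ [])     y Q = refl
  last-++-∷ (x ∷ x′ ∷ P) y Q = last-++-∷ (x′ ∷ P) y Q

  module _ {R : A → A → Set} where

    Linked-++-∷⁻ : ∀ (P : List A) y Q → Linked R (P ++ y ∷ Q) → Linked R (P ++ y ∷ []) × Linked R (y ∷ Q)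
    Linked-++-∷⁻ []           y Q l       = [-] , l
    Linked-++-∷⁻ (x ∷ [])     y Q (r ∷ l) = r ∷ [-] , l
    Linked-++-∷⁻ (x ∷ x′ ∷ P) y Q (r ∷ l) with Linked-++-∷⁻ (x′ ∷ P) y Q l
    ... | l₁ , l₂ = r ∷ l₁ , l₂

    Linked-++-∷⁺ : ∀ (P : List A) y Q → Linked R (P ++ y ∷ []) → Linked R (y ∷ Q) → Linked R (P ++ y ∷ Q)
    Linked-++-∷⁺ []           y Q _        l = l
    Linked-++-∷⁺ (x ∷ [])     y Q (r ∷ _)  l = r ∷ l
    Linked-++-∷⁺ (x ∷ x′ ∷ P) y Q (r ∷ l₁) l = r ∷ Linked-++-∷⁺ (x′ ∷ P) y Q l₁ l

HeavyEndpoint : (G : Graph) → ℚ → V G → Set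
HeavyEndpoint G t x = ∃[ y ] (Graph.E G x y × t ≤ Graph.w G x y)

module _ {G : Graph} where
  open Graph G

  WalkFrom-++-∷⁻ : ∀ {u v} P y Q → WalkFrom G u v (P ++ y ∷ Q) →
    WalkFrom G u y (P ++ y ∷ []) × WalkFrom G y v (y ∷ Q)
  WalkFrom-++-∷⁻ P y Q (lk , hd , ls) =
    (proj₁ lk′ , trans (sym (head-++-∷ P y Q)) hd , last-++-∷ P y []) ,
    (proj₂ lk′ , refl , trans (sym (last-++-∷ P y Q)) ls)
    where
    lk′ : Linked E (P ++ y ∷ []) × Linked E (y ∷ Q)
    lk′ = Linked-++-∷⁻ P y Q lk

  WalkFrom-++-∷⁺ : ∀ {u v} P y Q → WalkFrom G u y (P ++ y ∷ []) → WalkFrom G y v (y ∷ Q) →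
    WalkFrom G u v (P ++ y ∷ Q)
  WalkFrom-++-∷⁺ P y Q (lk₁ , hd₁ , _) (lk₂ , _ , ls₂) =
    Linked-++-∷⁺ P y Q lk₁ lk₂ , trans (head-++-∷ P y Q) hd₁ , trans (last-++-∷ P y Q) ls₂

  len-++-∷ : ∀ P y Q → len G (P ++ y ∷ Q) ≡ len G (P ++ y ∷ []) + len G (y ∷ Q)
  len-++-∷ []           y Q = sym (+-identityˡ _)
  len-++-∷ (x ∷ [])     y Q = cong (_+ len G (y ∷ Q)) (sym (+-identityʳ (w x y)))
  len-++-∷ (x ∷ x′ ∷ P) y Q = begin
    w x x′ + len G (x′ ∷ P ++ y ∷ Q)                     ≡⟨ cong (w x x′ +_) (len-++-∷ (x′ ∷ P) y Q) ⟩
    w x x′ + (len G (x′ ∷ P ++ y ∷ []) + len G (y ∷ Q))  ≡⟨ +-assoc (w x x′) _ _ ⟨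
    w x x′ + len G (x′ ∷ P ++ y ∷ []) + len G (y ∷ Q)    ∎
    where open ≡-Reasoning

  len-++-last : ∀ {v} p Q → last p ≡ just v → len G (p ++ Q) ≡ len G p + len G (v ∷ Q)
  len-++-last {v} p Q ls with last≡just⇒∷ʳ p ls
  ... | p₁ , refl = trans (cong (len G) (++-assoc p₁ (v ∷ []) Q)) (len-++-∷ p₁ v Q)

  IsSP-suffix : ∀ {u v} P y Q → IsSP G u v (P ++ y ∷ Q) → IsSP G y v (y ∷ Q)
  IsSP-suffix {v = v} P y Q (walk , shortest) = proj₂ (WalkFrom-++-∷⁻ P y Q walk) , shorter
    where
    shorter : ∀ W → WalkFrom G y v W → len G (y ∷ Q) ≤ len G W
    shorter W walkW with head≡just⇒∷ W (proj₁ (proj₂ walkW))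
    ... | W₀ , refl = +-cancelˡ-≤ (len G (P ++ y ∷ []))
      (subst₂ _≤_ (len-++-∷ P y Q) (len-++-∷ P y W₀)
        (shortest _ (WalkFrom-++-∷⁺ P y W₀ (proj₁ (WalkFrom-++-∷⁻ P y Q walk)) walkW)))

  IsSP-prefix : ∀ {u v} P y Q → IsSP G u v (P ++ y ∷ Q) → IsSP G u y (P ++ y ∷ [])
  IsSP-prefix {u = u} P y Q (walk , shortest) = proj₁ (WalkFrom-++-∷⁻ P y Q walk) , shorter
    where
    shorter : ∀ W → WalkFrom G u y W → len G (P ++ y ∷ []) ≤ len G W
    shorter W walkW with last≡just⇒∷ʳ W (proj₂ (proj₂ walkW))
    ... | W₁ , refl = +-cancelʳ-≤ (len G (y ∷ Q))
      (subst₂ _≤_ (len-++-∷ P y Q) (len-++-∷ W₁ y Q)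
        (shortest _ (WalkFrom-++-∷⁺ W₁ y Q walkW (proj₂ (WalkFrom-++-∷⁻ P y Q walk)))))

  IsSP-sandwich : ∀ {a b u v} as p bs → IsSP G a b (as ++ p ++ bs) → WalkFrom G u v p →
    IsSP G a u (as ++ u ∷ []) × IsSP G v b (v ∷ bs) ×
    len G (as ++ p ++ bs) ≡ len G (as ++ u ∷ []) + (len G p + len G (v ∷ bs))
  IsSP-sandwich {a} {b} {u} {v} as p bs sp (_ , hd , ls) with head≡just⇒∷ p hd | last≡just⇒∷ʳ p ls
  ... | p₀ , refl | p₁ , p≡p₁v =
    IsSP-prefix as u (p₀ ++ bs) sp ,
    IsSP-suffix (as ++ p₁) v bs (subst (IsSP G a b) reassoc sp) ,
    trans (len-++-∷ as u (p₀ ++ bs)) (cong (len G (as ++ u ∷ []) +_) (len-++-last p bs ls))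
    where
    reassoc : as ++ p ++ bs ≡ (as ++ p₁) ++ v ∷ bs
    reassoc = begin
      as ++ p ++ bs                ≡⟨ cong (λ q → as ++ q ++ bs) p≡p₁v ⟩
      as ++ (p₁ ++ v ∷ []) ++ bs   ≡⟨ cong (as ++_) (++-assoc p₁ (v ∷ []) bs) ⟩
      as ++ p₁ ++ v ∷ bs           ≡⟨ ++-assoc as p₁ (v ∷ bs) ⟨
      (as ++ p₁) ++ v ∷ bs         ∎
      where open ≡-Reasoning

  IsSP-≤-edge : ∀ {x y q} → IsSP G x y q → E x y → len G q ≤ w x y
  IsSP-≤-edge (_ , shortest) e =
    subst (_ ≤_) (+-identityʳ _) (shortest (_ ∷ _ ∷ []) (e ∷ [-] , refl , refl))

  IsSP-≤-0 : ∀ {x q} → IsSP G x x q → len G q ≤ 0ℚ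
  IsSP-≤-0 (_ , shortest) = shortest (_ ∷ []) ([-] , refl , refl)

  end-segment-short-or-heavy : ∀ {t} → 0ℚ < t → ∀ {x y q} → IsSP G x y q ⊎ IsSP G y x q →
    UOrNbr G x y → len G q < t ⊎ HeavyEndpoint G t x
  end-segment-short-or-heavy t>0 (inj₁ sp) (inj₁ refl) = inj₁ (≤-<-trans (IsSP-≤-0 sp) t>0)
  end-segment-short-or-heavy t>0 (inj₂ sp) (inj₁ refl) = inj₁ (≤-<-trans (IsSP-≤-0 sp) t>0)
  end-segment-short-or-heavy {t} t>0 {x} {y} sp (inj₂ e) with t ≤? w y x
  ... | yes t≤w = inj₂ (y , E-sym e , subst (t ≤_) (w-sym e) t≤w)
  ... | no  t≰w = inj₁ (≤-<-trans (len≤w sp) (≰⇒> t≰w))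
    where
    len≤w : ∀ {q} → IsSP G x y q ⊎ IsSP G y x q → len G q ≤ w y x
    len≤w {q} (inj₁ sp-xy) = subst (len G q ≤_) (w-sym (E-sym e)) (IsSP-≤-edge sp-xy (E-sym e))
    len≤w (inj₂ sp-yx) = IsSP-≤-edge sp-yx e

  maxedge-≤⊎heavy : ∀ {t} → 0ℚ ≤ t → ∀ {p} → Linked E p →
    maxedge G p ≤ t ⊎ ∃[ x ] (x ∈ p × HeavyEndpoint G t x)
  maxedge-≤⊎heavy t≥0 []  = inj₁ t≥0
  maxedge-≤⊎heavy t≥0 [-] = inj₁ t≥0
  maxedge-≤⊎heavy {t} t≥0 {x ∷ y ∷ _} (e ∷ lk) with w x y ≤? t
  ... | no  w≰t = inj₂ (x , here refl , y , e , <⇒≤ (≰⇒> w≰t))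
  ... | yes w≤t with maxedge-≤⊎heavy t≥0 lk
  ...   | inj₁ rest≤t             = inj₁ (⊔-lub w≤t rest≤t)
  ...   | inj₂ (z , z∈p , heavy) = inj₂ (z , there z∈p , heavy)

  Crossing : ℚ → List (V G) → Set
  Crossing t p = ∃[ as ] ∃[ a ] ∃[ y ] ∃[ q ]
    (p ≡ as ++ a ∷ y ∷ q × t < len G (a ∷ y ∷ q) × len G (y ∷ q) ≤ t)

  crossing-∷∷ : ∀ {t} → 0ℚ ≤ t → ∀ x y q → t < len G (x ∷ y ∷ q) → Crossing t (x ∷ y ∷ q)
  crossing-∷∷ t≥0 x y []      t<len = [] , x , y , [] , refl , t<len , t≥0
  crossing-∷∷ {t} t≥0 x y (z ∷ q) t<len with len G (y ∷ z ∷ q) ≤? t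
  ... | yes ≤t = [] , x , y , z ∷ q , refl , t<len , ≤t
  ... | no  ≰t with crossing-∷∷ t≥0 y z q (≰⇒> ≰t)
  ...   | as , a , y′ , q′ , eq , t< , ≤t = x ∷ as , a , y′ , q′ , cong (x ∷_) eq , t< , ≤t

  crossing : ∀ {t} → 0ℚ ≤ t → ∀ p → t < len G p → Crossing t p
  crossing t≥0 []          t<0   = ⊥-elim (<-irrefl refl (<-≤-trans t<0 t≥0))
  crossing t≥0 (x ∷ [])    t<0   = ⊥-elim (<-irrefl refl (<-≤-trans t<0 t≥0))
  crossing t≥0 (x ∷ y ∷ q) t<len = crossing-∷∷ t≥0 x y q t<len

  significant-meets : ∀ {r k C} → 0ℚ < r → VertexCover G (third r) k C →
    ∀ p → Significant G r p → Meets G (UnionHeavyEndpoints G (third r) C) p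
  significant-meets {r} r>0 cover p (u , v , sp , _ , a , b , sp′ , r≤ , (as , bs , refl) , ua , vb)
    with maxedge-≤⊎heavy (<⇒≤ (third-pos r>0)) (proj₁ (proj₁ sp))
  ... | inj₂ (x , x∈p , heavy) = x , x∈p , inj₂ heavy
  ... | inj₁ light with IsSP-sandwich as p bs sp′ (proj₁ sp)
  ...   | pre , suf , len≡ with end-segment-short-or-heavy (third-pos r>0) (inj₂ pre) ua
                              | end-segment-short-or-heavy (third-pos r>0) (inj₁ suf) vb
  ...     | inj₂ heavy | _          = u , head≡just⇒∈ p (proj₁ (proj₂ (proj₁ sp))) , inj₂ heavy
  ...     | inj₁ _     | inj₂ heavy = v , last≡just⇒∈ p (proj₂ (proj₂ (proj₁ sp))) , inj₂ heavy
  ...     | inj₁ pre<s | inj₁ suf<s =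
    map₂ (map₂ inj₁) (proj₁ cover u v p sp (long-middle 3s≤ pre<s suf<s) light)
    where
    3s≤ : third r + (third r + third r) ≤ len G (as ++ u ∷ []) + (len G p + len G (v ∷ bs))
    3s≤ = subst₂ _≤_ (sym (third-sum r)) len≡ r≤

module _ {G : Graph} (SA : StandingAssumptions G) where
  open Graph G
  open StandingAssumptions SA

  len-nonneg : ∀ {p} → Linked E p → 0ℚ ≤ len G p
  len-nonneg []       = ≤-refl
  len-nonneg [-]      = ≤-refl
  len-nonneg (e ∷ lk) = +-mono-≤ (≤-trans (nonNegative⁻¹ 1ℚ) (weight≥1 e)) (len-nonneg lk)

  IsSP-[-] : ∀ x → IsSP G x x (x ∷ [])
  IsSP-[-] x = ([-] , refl , refl) , λ _ walk → len-nonneg (proj₁ walk)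

  len-suffix-≤ : ∀ P y Q → Linked E (P ++ y ∷ Q) → len G (y ∷ Q) ≤ len G (P ++ y ∷ Q)
  len-suffix-≤ P y Q lk = begin
    len G (y ∷ Q)                               ≡⟨ +-identityˡ _ ⟨
    0ℚ + len G (y ∷ Q)                          ≤⟨ +-monoˡ-≤ _ (len-nonneg (proj₁ (Linked-++-∷⁻ P y Q lk))) ⟩
    len G (P ++ y ∷ []) + len G (y ∷ Q)         ≡⟨ len-++-∷ P y Q ⟨
    len G (P ++ y ∷ Q)                          ∎
    where open ≤-Reasoning

  ∈-IsSP⇒Ball : ∀ {ρ y x z q} → IsSP G y x q → len G q ≤ ρ → z ∈ q → Ball G z ρ x
  ∈-IsSP⇒Ball {z = z} sp len≤ρ z∈q with ∈-∃++ z∈q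
  ... | q₁ , q₂ , refl =
    z ∷ q₂ , IsSP-suffix q₁ z q₂ sp , ≤-trans (len-suffix-≤ q₁ z q₂ (proj₁ (proj₁ sp))) len≤ρ

  crossing-InS : ∀ {ρ v x} as a y q → IsSP G v x (as ++ a ∷ y ∷ q) →
    ρ < len G (a ∷ y ∷ q) → len G (as ++ a ∷ y ∷ q) ≤ (ρ + ρ) + ρ → InS G v ρ (y ∷ q)
  crossing-InS {ρ} {x = x} as a y q sp ρ<len len≤3ρ =
    y , x , IsSP-suffix (a ∷ []) y q sp-a ,
    a ∷ y ∷ q , (a , x , sp-a , <⇒≤ ρ<len , (a ∷ [] , [] , subpath) , inj₂ a—y , inj₁ refl) ,
    (a , here refl , as ++ a ∷ [] , IsSP-prefix as a (y ∷ q) sp , prefix≤2ρ)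
    where
    sp-a : IsSP G a x (a ∷ y ∷ q)
    sp-a = IsSP-suffix as a (y ∷ q) sp
    a—y : E a y
    a—y = Linked.head (proj₁ (proj₁ sp-a))
    subpath : a ∷ y ∷ q ≡ a ∷ (y ∷ q) ++ []
    subpath = cong (a ∷_) (sym (++-identityʳ (y ∷ q)))
    prefix≤2ρ : len G (as ++ a ∷ []) ≤ ρ + ρ
    prefix≤2ρ = +-cancelʳ-≤ ρ (begin
      len G (as ++ a ∷ []) + ρ                   ≤⟨ +-monoʳ-≤ (len G (as ++ a ∷ [])) (<⇒≤ ρ<len) ⟩
      len G (as ++ a ∷ []) + len G (a ∷ y ∷ q)   ≡⟨ len-++-∷ as a (y ∷ q) ⟨
      len G (as ++ a ∷ y ∷ q)                    ≤⟨ len≤3ρ ⟩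
      (ρ + ρ) + ρ                                ∎)
      where open ≤-Reasoning

  ball-cover : ∀ {ρ v H x} → 0ℚ ≤ ρ → (∀ p → InS G v ρ p → Meets G (_∈ H) p) →
    Ball G v ((ρ + ρ) + ρ) x → Any (λ z → Ball G z ρ x) (v ∷ H)
  ball-cover {ρ} ρ≥0 hits (p , sp , len≤3ρ) with len G p ≤? ρ
  ... | yes len≤ρ = here (p , sp , len≤ρ)
  ... | no  len≰ρ with crossing ρ≥0 p (≰⇒> len≰ρ)
  ...   | as , a , y , q , refl , ρ<len , tail≤ρ
          with hits (y ∷ q) (crossing-InS as a y q sp ρ<len len≤3ρ)
  ...     | z , z∈yq , z∈H =
    there (lose z∈H (∈-IsSP⇒Ball (IsSP-suffix (a ∷ []) y q (IsSP-suffix as a (y ∷ q) sp)) tail≤ρ z∈yq))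

  heavy-InS : ∀ {t z x} → HeavyEndpoint G t x → Ball G z (t + t) x → InS G z t (x ∷ [])
  heavy-InS {t} {x = x} (y , e , t≤w) x∈B =
    x , x , IsSP-[-] x ,
    x ∷ y ∷ [] , (x , y , edgeIsSP e , subst (t ≤_) (sym (+-identityʳ _)) t≤w ,
                  ([] , y ∷ [] , refl) , inj₁ refl , inj₂ (E-sym e)) ,
    (x , here refl , x∈B)

  heavy-count : ∀ {h t} → HighwayDimAtMost G h → 0ℚ < t →
    ∀ z → HasAtMost h (Ball G z (t + t) ∩ HeavyEndpoint G t)
  heavy-count {t = t} hd t>0 z with hd t t>0 z
  ... | H , |H|≤h , hits = HasAtMost-weaken |H|≤h (HasAtMost-mono hub (HasAtMost-∈ H))
    where
    hub : Ball G z (t + t) ∩ HeavyEndpoint G t ⊆ (_∈ H)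
    hub (x∈B , heavy) with hits _ (heavy-InS heavy x∈B)
    ... | _ , here refl , x∈H = x∈H

  ball-count : ∀ {ρ b v H} {U : Pred (V G) 0ℓ} → 0ℚ ≤ ρ → (∀ z → HasAtMost b (Ball G z ρ ∩ U)) →
    (∀ p → InS G v ρ p → Meets G (_∈ H) p) →
    HasAtMost (suc (length H) ℕ.* b) (Ball G v ((ρ + ρ) + ρ) ∩ U)
  ball-count {v = v} {H} ρ≥0 local hits =
    HasAtMost-mono (λ (x∈B , ux) → Any.map (_, ux) (ball-cover ρ≥0 hits x∈B)) (HasAtMost-⋃ local (v ∷ H))

  local-count : ∀ {h k s C} → HighwayDimAtMost G h → 0ℚ < s → VertexCover G s k C →
    ∀ z → HasAtMost (k ℕ.+ h) (Ball G z (s + s) ∩ UnionHeavyEndpoints G s C)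
  local-count {s = s} {C} hd s>0 cover z =
    HasAtMost-mono distrib (HasAtMost-∪ (proj₂ cover z) (heavy-count hd s>0 z))
    where
    distrib : Ball G z (s + s) ∩ UnionHeavyEndpoints G s C ⊆
              (Ball G z (s + s) ∩ C) ∪ (Ball G z (s + s) ∩ HeavyEndpoint G s)
    distrib (x∈B , inj₁ c)     = inj₁ (x∈B , c)
    distrib (x∈B , inj₂ heavy) = inj₂ (x∈B , heavy)

  SPHS-sparse : ∀ {h k r C} → HighwayDimAtMost G h → 0ℚ < r → VertexCover G (third r) k C →
    ∀ v → AtMost G (suc h ℕ.* (k ℕ.+ h)) (Ball G v (r + r) ∩ UnionHeavyEndpoints G (third r) C)
  SPHS-sparse {h} {k} {r} {C} hd r>0 cover v
    with hd (third r + third r) (double-pos (third-pos r>0)) v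
  ... | H , |H|≤h , hits =
    HasAtMost-weaken (ℕ.*-monoˡ-≤ (k ℕ.+ h) (s≤s |H|≤h))
      (subst (λ R → HasAtMost _ (Ball G v R ∩ UnionHeavyEndpoints G (third r) C)) (sym (double-sixths r))
        (ball-count (<⇒≤ (double-pos (third-pos r>0))) (local-count hd (third-pos r>0) cover) hits))

mainTheorem8 : ∀ (h k : ℕ) → ∃[ c ] (∀ (G : Graph) → StandingAssumptions G →
    HighwayDimAtMost G h → ∀ (r : ℚ) → 0ℚ < r → ∀ (C : V G → Set) →
    VertexCover G (third r) k C →
    SPHS G r c (UnionHeavyEndpoints G (third r) C))
mainTheorem8 h k = suc h ℕ.* (k ℕ.+ h) , λ G SA hd r r>0 C cover →
  significant-meets r>0 cover , SPHS-sparse SA hd r>0 cover
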